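{- None of the frame properties seriality, reflexivity, Euclideanity and convergency is definable in $\mathcal{L}(\nabla,\bullet)$; that is, for each of these properties $P$ there is no formula $\varphi\in\mathcal{L}(\nabla,\bullet)$ such that for all frames $\mathcal{F}$, $\mathcal{F}\vDash\varphi$ iff $\mathcal{F}$ has $P$.
   Context: Fix a nonempty set $\mathbf{P}$ of propositional variables. $\mathcal{L}(\nabla,\bullet)$: $\varphi::=p\mid\neg\varphi\mid\varphi\land\varphi\mid\nabla\varphi\mid\bullet\varphi$ ($p\in\mathbf{P}$). A frame is $\mathcal{F}=\langle S,R\rangle$ with $S$ nonempty, $R\subseteq S\times S$; a model on it adds $V:\mathbf{P}\to\mathcal{P}(S)$. Truth: $\mathcal{M},s\vDash p$ iff $s\in V(p)$; Booleans as usual; $\mathcal{M},s\vDash\nabla\varphi$ iff there are $t,u$ with $sRt$, $sRu$, $\mathcal{M},t\vDash\varphi$, $\mathcal{M},u\nvDash\varphi$; $\mathcal{M},s\vDash\bullet\varphi$ iff $\mathcal{M},s\vDash\varphi$ and some $t$ with $sRt$ has $\mathcal{M},t\nvDash\varphi$. $\mathcal{F}\vDash\varphi$ means $\varphi$ is true at every state of every model on $\mathcal{F}$. Seriality: every state has an $R$-successor; reflexivity: $xRx$ for all $x$; Euclideanity: $xRy$ and $xRz$ imply $yRz$; convergency: $xRy$ and $xRz$ imply there is $w$ with $yRw$ and $zRw$. -}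

module Defs where

open import Data.Product using (Σ; ∃; ∃-syntax; _×_; _,_)
open import Data.Empty using (⊥)
open import Relation.Nullary using (¬_)

data Form (Var : Set) : Set where
  var  : Var → Form Var
  neg  : Form Var → Form Var
  and  : Form Var → Form Var → Form Var
  nabla : Form Var → Form Var
  bullet : Form Var → Form Var

record Frame : Set₁ where
  field
    S    : Set
    R    : S → S → Set
    elem : S   -- nonemptiness witness

open Frame public

Valuation : (Var : Set) → Frame → Set₁
Valuation Var F = Var → S F → Set

sat : {Var : Set} (F : Frame) → Valuation Var F → S F → Form Var → Set
sat F V s (var p)    = V p s
sat F V s (neg φ)    = ¬ sat F V s φ
sat F V s (and φ ψ)  = sat F V s φ × sat F V s ψ
sat F V s (nabla φ)  = ∃[ t ] ∃[ u ] (R F s t × R F s u × sat F V t φ × ¬ sat F V u φ)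
sat F V s (bullet φ) = sat F V s φ × (∃[ t ] (R F s t × ¬ sat F V t φ))

valid : {Var : Set} → Frame → Form Var → Set₁
valid {Var} F φ = (V : Valuation Var F) (s : S F) → sat F V s φ

Serial : Frame → Set
Serial F = (x : S F) → ∃[ y ] R F x y

Reflexive : Frame → Set
Reflexive F = (x : S F) → R F x x

Euclidean : Frame → Set
Euclidean F = (x y z : S F) → R F x y → R F x z → R F y z

Convergent : Frame → Set
Convergent F = (x y z : S F) → R F x y → R F x z → ∃[ w ] (R F y w × R F z w)

Definable : (Var : Set) → (Frame → Set) → Set₁
Definable Var P = Σ (Form Var) (λ φ → (F : Frame) → (valid F φ → P F) × (P F → valid F φ))

-- A reflexive loop is invisible to •: •φ at s needs a successor refuting φ, and s itself
-- satisfies φ. On frames where every state has at most one successor, ∇ is never true.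
-- Hence erasing loops from such a frame preserves the truth of every formula, and every
-- formula valid on the frame stays valid on its loop-free version.
-- The one-unit-deterministic loop and the one-unit-deterministic dead end separate seriality and reflexivity; the
-- two-unit-deterministic frames 0 → 1 ↺ and 0 → 1 separate Euclideanity and convergency.
module Submission where

open import Defs
open import Data.Bool using (Bool; true; false)
open import Data.Empty using (⊥; ⊥-elim)
open import Data.Product using (_×_; _,_; proj₁; proj₂)
open import Data.Sum using (_⊎_; inj₁; inj₂)
open import Data.Unit using (⊤; tt)
open import Function.Bundles using (_⇔_; mk⇔; Equivalence)
open import Relation.Binary.PropositionalEquality using (_≡_; refl; subst)
open import Relation.Nullary using (¬_)

open Equivalence using (to; from)

frame : {A : Set} → A → (A → A → Set) → Frame
frame {A} a Rel = record { S = A ; R = Rel ; elem = a }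

Deterministic : {A : Set} → (A → A → Set) → Set
Deterministic Rel = ∀ x {y z} → Rel x y → Rel x z → y ≡ z

deterministic⇒¬nabla : ∀ {Var} (H : Frame) → Deterministic (R H) →
                       (V : Valuation Var H) (s : S H) (φ : Form Var) → ¬ sat H V s (nabla φ)
deterministic⇒¬nabla H det V s φ (t , u , st , su , φt , ¬φu) =
  ¬φu (subst (λ w → sat H V w φ) (det s st su) φt)

module LoopErasure {A : Set} (a : A) (Rel Rel′ : A → A → Set)
  (deterministic : Deterministic Rel)
  (erase : ∀ {x y} → Rel x y → Rel′ x y ⊎ x ≡ y)
  (sub : ∀ {x y} → Rel′ x y → Rel x y)
  where

  F G : Frame
  F = frame a Rel
  G = frame a Rel′

  sat-⇔ : ∀ {Var} (V : Var → A → Set) (s : A) (φ : Form Var) → sat F V s φ ⇔ sat G V s φ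
  sat-⇔ V s (var p) = mk⇔ (λ x → x) (λ x → x)
  sat-⇔ V s (neg φ) = mk⇔ (λ ¬φ φ′ → ¬φ (from (sat-⇔ V s φ) φ′)) (λ ¬φ φ′ → ¬φ (to (sat-⇔ V s φ) φ′))
  sat-⇔ V s (and φ ψ) =
    mk⇔ (λ (p , q) → to (sat-⇔ V s φ) p , to (sat-⇔ V s ψ) q)
        (λ (p , q) → from (sat-⇔ V s φ) p , from (sat-⇔ V s ψ) q)
  sat-⇔ V s (nabla φ) =
    mk⇔ (λ h → ⊥-elim (deterministic⇒¬nabla F deterministic V s φ h))
        (λ h → ⊥-elim (deterministic⇒¬nabla G (λ x p q → deterministic x (sub p) (sub q)) V s φ h))
  sat-⇔ V s (bullet φ) = mk⇔ erased restored
    where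
    erased : sat F V s (bullet φ) → sat G V s (bullet φ)
    erased (φs , t , st , ¬φt) with erase st
    ... | inj₁ st′ = to (sat-⇔ V s φ) φs , t , st′ , λ φt → ¬φt (from (sat-⇔ V t φ) φt)
    ... | inj₂ refl = ⊥-elim (¬φt φs)
    restored : sat G V s (bullet φ) → sat F V s (bullet φ)
    restored (φs , t , st , ¬φt) = from (sat-⇔ V s φ) φs , t , sub st , λ φt → ¬φt (to (sat-⇔ V t φ) φt)

  valid-erase : ∀ {Var} (φ : Form Var) → valid F φ → valid G φ
  valid-erase φ v V s = to (sat-⇔ V s φ) (v V s)

undefinable : ∀ {Var} {P : Frame → Set} (F G : Frame) →
              (∀ (φ : Form Var) → valid F φ → valid G φ) → P F → ¬ P G → ¬ Definable Var P
undefinable F G transfer PF ¬PG (φ , defines) =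
  ¬PG (proj₁ (defines G) (transfer φ (proj₂ (defines F) PF)))

unit-deterministic : Deterministic {⊤} (λ _ _ → ⊤)
unit-deterministic _ _ _ = refl

module OnePoint = LoopErasure tt (λ _ _ → ⊤) (λ _ _ → ⊥) unit-deterministic (λ _ → inj₂ refl) (λ ())

-- 0 → 1 ↺, encoded on Bool as false → true ↺.
ToTrue : Bool → Bool → Set
ToTrue _ true  = ⊤
ToTrue _ false = ⊥

FalseToTrue : Bool → Bool → Set
FalseToTrue false true = ⊤
FalseToTrue _     _    = ⊥

toTrue-deterministic : Deterministic ToTrue
toTrue-deterministic _ {true} {true} _ _ = refl

toTrue-erase : ∀ {x y} → ToTrue x y → FalseToTrue x y ⊎ x ≡ y
toTrue-erase {false} {true} _ = inj₁ tt
toTrue-erase {true}  {true} _ = inj₂ refl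

falseToTrue⊆toTrue : ∀ {x y} → FalseToTrue x y → ToTrue x y
falseToTrue⊆toTrue {false} {true} _ = tt

module TwoPoint = LoopErasure true ToTrue FalseToTrue
  toTrue-deterministic toTrue-erase falseToTrue⊆toTrue

toTrue-euclidean : Euclidean TwoPoint.F
toTrue-euclidean _ _ true _ _ = tt

falseToTrue-not-convergent : ¬ Convergent TwoPoint.G
falseToTrue-not-convergent conv with conv false true true tt tt
... | false , () , _
... | true  , () , _

mainTheorem7 : (Var : Set) → Var →
    ¬ Definable Var Serial × ¬ Definable Var Reflexive ×
    ¬ Definable Var Euclidean × ¬ Definable Var Convergent
mainTheorem7 Var _ =
    undefinable OnePoint.F OnePoint.G OnePoint.valid-erase (λ _ → tt , tt) (λ serial → proj₂ (serial tt))
  , undefinable OnePoint.F OnePoint.G OnePoint.valid-erase (λ _ → tt) (λ reflexive → reflexive tt)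
  , undefinable TwoPoint.F TwoPoint.G TwoPoint.valid-erase toTrue-euclidean
      (λ euclidean → euclidean false true true tt tt)
  , undefinable TwoPoint.F TwoPoint.G TwoPoint.valid-erase (λ _ _ _ _ _ → true , tt , tt)
      falseToTrue-not-convergent
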